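{- Let $T$ be a nonabelian simple group and $T\leqslant A\leqslant B\leqslant\mathrm{Aut}(T)$. Suppose $H$ is a maximal subgroup of $B$ with $B=TH$ and $T\cap H\neq1$. Let $k\ge1$, $$G=\langle A^k,(b,\ldots,b)\mid b\in B\rangle\rtimes S_k,\qquad L=\langle (A\cap H)^k,(h,\ldots,h)\mid h\in H\rangle\rtimes S_k,$$ as subgroups of $B\wr S_k=B^k\rtimes S_k$ (with $S_k$ permuting coordinates). Then $L$ is a maximal subgroup of $G$. -}

module Defs where

open import Level using (Level; _⊔_; suc)
open import Algebra.Bundles using (Group)
open import Data.Nat using (ℕ)
open import Data.Fin using (Fin)
open import Data.Product using (Σ; ∃; ∃₂; _×_; _,_)
open import Data.Sum using (_⊎_)
open import Relation.Nullary using (¬_)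
open import Relation.Unary using (Pred; _⊆_; _∈_)
open import Relation.Binary.PropositionalEquality using (_≡_)
import Data.Fin.Permutation as P
open P using (Permutation′; _⟨$⟩ʳ_; _⟨$⟩ˡ_; _∘ₚ_)
import Relation.Binary.Reasoning.Setoid as SetoidReasoning

-- Used only to phrase "subgroup", "generated subgroup", "maximal subgroup"
-- uniformly for Aut(T), Aut(T)^k and the wreath product Aut(T) ≀ S_k.

record GroupOps (c ℓ : Level) : Set (suc (c ⊔ ℓ)) where
  field
    Carrier : Set c
    _≈_     : Carrier → Carrier → Set ℓ
    _·_     : Carrier → Carrier → Carrier
    e       : Carrier
    inv     : Carrier → Carrier

module _ {c ℓ : Level} (G : GroupOps c ℓ) where
  open GroupOps G

  record IsSubgroup {p : Level} (S : Pred Carrier p) : Set (c ⊔ ℓ ⊔ p) where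
    field
      resp  : ∀ {x y} → x ≈ y → S x → S y
      has-e : S e
      mul   : ∀ {x y} → S x → S y → S (x · y)
      inv-closed : ∀ {x} → S x → S (inv x)

  data Gen {p : Level} (X : Pred Carrier p) : Pred Carrier (c ⊔ ℓ ⊔ p) where
    gen  : ∀ {x} → X x → Gen X x
    gen-e    : Gen X e
    gen-mul  : ∀ {x y} → Gen X x → Gen X y → Gen X (x · y)
    gen-inv  : ∀ {x} → Gen X x → Gen X (inv x)
    gen-resp : ∀ {x y} → x ≈ y → Gen X x → Gen X y

  record IsMaximalSubgroupOf (L M : Pred Carrier (c ⊔ ℓ)) : Set (suc (c ⊔ ℓ)) where
    field
      subgroup : IsSubgroup L
      sub      : L ⊆ M
      proper   : ∃ λ x → M x × ¬ L x
      maximal  : (K : Pred Carrier (c ⊔ ℓ)) → IsSubgroup K → L ⊆ K → K ⊆ M →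
                 (K ⊆ L) ⊎ (M ⊆ K)

module _ {c ℓ : Level} (T : Group c ℓ) where
  open Group T

  record IsNormalSubgroup (N : Pred Carrier (c ⊔ ℓ)) : Set (c ⊔ ℓ) where
    field
      resp  : ∀ {x y} → x ≈ y → N x → N y
      has-ε : N ε
      mul   : ∀ {x y} → N x → N y → N (x ∙ y)
      inv-closed : ∀ {x} → N x → N (x ⁻¹)
      conj  : ∀ {x} (g : Carrier) → N x → N ((g ∙ x) ∙ (g ⁻¹))

  IsSimple : Set (suc (c ⊔ ℓ))
  IsSimple = (∃ λ x → ¬ (x ≈ ε)) ×
             ((N : Pred Carrier (c ⊔ ℓ)) → IsNormalSubgroup N →
               (∀ x → N x → x ≈ ε) ⊎ (∀ x → N x))

  IsNonabelian : Set (c ⊔ ℓ)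
  IsNonabelian = ∃₂ λ x y → ¬ ((x ∙ y) ≈ (y ∙ x))

module _ {c ℓ : Level} (T : Group c ℓ) where
  open Group T

  record Automorphism : Set (c ⊔ ℓ) where
    field
      to      : Carrier → Carrier
      from    : Carrier → Carrier
      to-cong   : ∀ {x y} → x ≈ y → to x ≈ to y
      from-cong : ∀ {x y} → x ≈ y → from x ≈ from y
      to-hom  : ∀ x y → to (x ∙ y) ≈ (to x ∙ to y)
      to-from : ∀ x → to (from x) ≈ x
      from-to : ∀ x → from (to x) ≈ x

  open Automorphism

  private
    from-hom : (α : Automorphism) → ∀ x y → from α (x ∙ y) ≈ (from α x ∙ from α y)
    from-hom α x y = begin
        from α (x ∙ y)
      ≈⟨ from-cong α (∙-cong (sym (to-from α x)) (sym (to-from α y))) ⟩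
        from α (to α (from α x) ∙ to α (from α y))
      ≈⟨ from-cong α (sym (to-hom α (from α x) (from α y))) ⟩
        from α (to α (from α x ∙ from α y))
      ≈⟨ from-to α _ ⟩
        from α x ∙ from α y ∎
      where open SetoidReasoning setoid

  autId : Automorphism
  autId = record
    { to = λ x → x ; from = λ x → x
    ; to-cong = λ p → p ; from-cong = λ p → p
    ; to-hom = λ _ _ → refl ; to-from = λ _ → refl ; from-to = λ _ → refl }

  autComp : Automorphism → Automorphism → Automorphism
  autComp α β = record
    { to = λ x → to α (to β x)
    ; from = λ x → from β (from α x)
    ; to-cong = λ p → to-cong α (to-cong β p)
    ; from-cong = λ p → from-cong β (from-cong α p)
    ; to-hom = λ x y → trans (to-cong α (to-hom β x y)) (to-hom α _ _)
    ; to-from = λ x → trans (to-cong α (to-from β _)) (to-from α x)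
    ; from-to = λ x → trans (from-cong β (from-to α _)) (from-to β x) }

  autInv : Automorphism → Automorphism
  autInv α = record
    { to = from α ; from = to α
    ; to-cong = from-cong α ; from-cong = to-cong α
    ; to-hom = from-hom α ; to-from = from-to α ; from-to = to-from α }

  _≈Aut_ : Automorphism → Automorphism → Set (c ⊔ ℓ)
  α ≈Aut β = ∀ x → to α x ≈ to β x

  AutOps : GroupOps (c ⊔ ℓ) (c ⊔ ℓ)
  AutOps = record
    { Carrier = Automorphism ; _≈_ = _≈Aut_ ; _·_ = autComp
    ; e = autId ; inv = autInv }

  -- Inn(T), i.e. the copy of T inside Aut(T): α is conjugation by some t.
  IsInner : Pred Automorphism (c ⊔ ℓ)
  IsInner α = ∃ λ t → ∀ x → to α x ≈ ((t ∙ x) ∙ (t ⁻¹))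

  PowOps : ℕ → GroupOps (c ⊔ ℓ) (c ⊔ ℓ)
  PowOps k = record
    { Carrier = Fin k → Automorphism
    ; _≈_ = λ f g → ∀ i → f i ≈Aut g i
    ; _·_ = λ f g i → autComp (f i) (g i)
    ; e = λ _ → autId
    ; inv = λ f i → autInv (f i) }

  _^ᵖ_ : Pred Automorphism (c ⊔ ℓ) → (k : ℕ) → Pred (Fin k → Automorphism) (c ⊔ ℓ)
  X ^ᵖ k = λ f → ∀ i → X (f i)

  Diag : (k : ℕ) → Pred Automorphism (c ⊔ ℓ) → Pred (Fin k → Automorphism) (c ⊔ ℓ)
  Diag k X = λ f → ∃ λ b → X b × (∀ i → f i ≈Aut b)

  -- Wreath product Aut(T) ≀ S_k = Aut(T)^k ⋊ S_k, S_k permuting coordinates: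
  -- σ acts by (σ·g)(i) = g(σ⁻¹ i), and (f,σ)(g,τ) = (f·(σ·g), στ),
  -- where στ means "first τ, then σ".

  record WrElem (k : ℕ) : Set (c ⊔ ℓ) where
    constructor _⋊_
    field
      base : Fin k → Automorphism
      perm : Permutation′ k

  WrOps : ℕ → GroupOps (c ⊔ ℓ) (c ⊔ ℓ)
  WrOps k = record
    { Carrier = WrElem k
    ; _≈_ = λ x y → (∀ i → WrElem.base x i ≈Aut WrElem.base y i) ×
                    (∀ i → WrElem.perm x ⟨$⟩ʳ i ≡ WrElem.perm y ⟨$⟩ʳ i)
    ; _·_ = λ { (f ⋊ σ) (g ⋊ τ) → (λ i → autComp (f i) (g (σ ⟨$⟩ˡ i))) ⋊ (τ ∘ₚ σ) }
    ; e = (λ _ → autId) ⋊ P.id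
    ; inv = λ { (f ⋊ σ) → (λ i → autInv (f (σ ⟨$⟩ʳ i))) ⋊ P.flip σ } }

  _⋊Sym : {k : ℕ} → Pred (Fin k → Automorphism) (c ⊔ ℓ) → Pred (WrElem k) (c ⊔ ℓ)
  N ⋊Sym = λ x → N (WrElem.base x)

  _∩_ : Pred Automorphism (c ⊔ ℓ) → Pred Automorphism (c ⊔ ℓ) → Pred Automorphism (c ⊔ ℓ)
  X ∩ Y = λ α → X α × Y α

module Submission where

-- Write Lᵇ and Gᵇ for the base groups, so that L = Lᵇ ⋊ S_k and G = Gᵇ ⋊ S_k.
-- Since B = Inn(T)·H and Inn(T) ⊴ Aut(T), every element of Gᵇ factors as
-- τ·m with τ ∈ Inn(T)^k and m ∈ Lᵇ; hence an element of Gᵇ with all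
-- coordinates in H already lies in Lᵇ.  Now let L ≤ K ≤ G.  As K contains all
-- of S_k, K = K₀ ⋊ S_k for the subgroup K₀ = {f | (f, 1) ∈ K}, which is closed
-- under permuting coordinates.  Its projection Π to the first coordinate
-- satisfies H ≤ Π ≤ B, so Π = H or Π = B by maximality of H.  If Π = H then
-- every coordinate of every f ∈ K₀ lies in H, so K₀ ≤ Lᵇ and K ≤ L.  If Π = B,
-- then for each coordinate j the elements s ∈ T whose conjugation, placed at
-- coordinate j, lies in K₀ form a normal subgroup of T, nontrivial because
-- T ∩ H ≠ 1; by simplicity it is T, so Inn(T)^k ≤ K₀, whence Gᵇ ≤ K₀, K = G.

open import Defs
open import Level using (Level; _⊔_)
open import Algebra.Bundles using (Group)
open import Data.Nat using (ℕ; _≤_; zero; suc; z≤n; s≤s)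
open import Data.Fin using (Fin; zero; suc)
open import Data.Fin.Properties using (_≟_)
import Data.Fin.Permutation as P
open P using (Permutation′; _⟨$⟩ʳ_)
import Data.Fin.Permutation.Components as PC
open import Data.Vec.Functional using (_∷_)
open import Data.Product using (∃; ∃₂; _×_; _,_; proj₁; proj₂)
open import Data.Sum using (_⊎_; inj₁; inj₂)
open import Data.Empty using (⊥-elim)
open import Relation.Nullary using (¬_)
open import Relation.Nullary.Decidable using (dec-true)
open import Relation.Unary using (Pred; _⊆_)
import Relation.Binary.PropositionalEquality as Eq
open Eq using (_≡_)
import Relation.Binary.Reasoning.Setoid as SetoidReasoning
import Algebra.Properties.Group as GroupProperties

module _ {c ℓ p : Level} {G : GroupOps c ℓ} {X : Pred (GroupOps.Carrier G) p} where

  Gen-isSubgroup : IsSubgroup G (Gen G X)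
  Gen-isSubgroup = record
    { resp = gen-resp ; has-e = gen-e ; mul = gen-mul ; inv-closed = gen-inv }

  Gen-least : ∀ {q} {S : Pred (GroupOps.Carrier G) q} →
              IsSubgroup G S → X ⊆ S → Gen G X ⊆ S
  Gen-least sS X⊆S (gen x)        = X⊆S x
  Gen-least sS X⊆S gen-e          = IsSubgroup.has-e sS
  Gen-least sS X⊆S (gen-mul x y)  = IsSubgroup.mul sS (Gen-least sS X⊆S x) (Gen-least sS X⊆S y)
  Gen-least sS X⊆S (gen-inv x)    = IsSubgroup.inv-closed sS (Gen-least sS X⊆S x)
  Gen-least sS X⊆S (gen-resp e x) = IsSubgroup.resp sS e (Gen-least sS X⊆S x)

-- Automorphisms and inner automorphisms of a group T.

module Automorphisms {c ℓ : Level} (T : Group c ℓ) where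
  open Group T
  open GroupProperties T
  open Automorphism public
  open SetoidReasoning setoid

  Aut : Set (c ⊔ ℓ)
  Aut = Automorphism T

  infix 4 _≃_
  infixr 9 _∘ᴬ_
  _≃_ : Aut → Aut → Set (c ⊔ ℓ)
  _≃_ = _≈Aut_ T
  _∘ᴬ_ : Aut → Aut → Aut
  _∘ᴬ_ = autComp T
  _⁻¹ᴬ : Aut → Aut
  _⁻¹ᴬ = autInv T
  idᴬ : Aut
  idᴬ = autId T

  -- Automorphisms enter types only through  to , from which Agda cannot
  -- infer them; lemmas about automorphisms therefore take them explicitly.

  ≡⇒≃ : ∀ {α β} → α ≡ β → α ≃ β
  ≡⇒≃ Eq.refl x = refl

  ⁻¹ᴬ-cong : ∀ α β → α ≃ β → α ⁻¹ᴬ ≃ β ⁻¹ᴬ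
  ⁻¹ᴬ-cong α β p x = begin
    from α x                  ≈⟨ from-cong α (sym (to-from β x)) ⟩
    from α (to β (from β x))  ≈⟨ from-cong α (sym (p _)) ⟩
    from α (to α (from β x))  ≈⟨ from-to α _ ⟩
    from β x                  ∎

  to-ε : ∀ (α : Aut) → to α ε ≈ ε
  to-ε α = identityʳ-unique (to α ε) (to α ε)
             (trans (sym (to-hom α ε ε)) (to-cong α (identityˡ ε)))

  to-⁻¹ : ∀ (α : Aut) s → to α (s ⁻¹) ≈ to α s ⁻¹
  to-⁻¹ α s = inverseˡ-unique _ _
    (trans (sym (to-hom α _ _)) (trans (to-cong α (inverseˡ s)) (to-ε α)))

  conj-conj⁻ : ∀ g x → (g ∙ ((g ⁻¹ ∙ x) ∙ g)) ∙ g ⁻¹ ≈ x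
  conj-conj⁻ g x = begin
    (g ∙ ((g ⁻¹ ∙ x) ∙ g)) ∙ g ⁻¹  ≈⟨ ∙-congʳ (sym (assoc _ _ _)) ⟩
    ((g ∙ (g ⁻¹ ∙ x)) ∙ g) ∙ g ⁻¹  ≈⟨ //-rightDividesʳ g _ ⟩
    g ∙ (g ⁻¹ ∙ x)                 ≈⟨ \\-leftDividesˡ g x ⟩
    x                              ∎

  conj⁻-conj : ∀ g x → (g ⁻¹ ∙ ((g ∙ x) ∙ g ⁻¹)) ∙ g ≈ x
  conj⁻-conj g x = begin
    (g ⁻¹ ∙ ((g ∙ x) ∙ g ⁻¹)) ∙ g  ≈⟨ assoc _ _ _ ⟩
    g ⁻¹ ∙ (((g ∙ x) ∙ g ⁻¹) ∙ g)  ≈⟨ ∙-congˡ (//-rightDividesˡ g _) ⟩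
    g ⁻¹ ∙ (g ∙ x)                 ≈⟨ \\-leftDividesʳ g x ⟩
    x                              ∎

  IsConj : Carrier → Aut → Set (c ⊔ ℓ)
  IsConj s α = ∀ x → to α x ≈ (s ∙ x) ∙ s ⁻¹

  conjAut : Carrier → Aut
  conjAut g = record
    { to = λ x → (g ∙ x) ∙ g ⁻¹
    ; from = λ x → (g ⁻¹ ∙ x) ∙ g
    ; to-cong = λ p → ∙-congʳ (∙-congˡ p)
    ; from-cong = λ p → ∙-congʳ (∙-congˡ p)
    ; to-hom = hom
    ; to-from = conj-conj⁻ g
    ; from-to = conj⁻-conj g }
    where
      hom : ∀ x y → (g ∙ (x ∙ y)) ∙ g ⁻¹ ≈ ((g ∙ x) ∙ g ⁻¹) ∙ ((g ∙ y) ∙ g ⁻¹)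
      hom x y = begin
        (g ∙ (x ∙ y)) ∙ g ⁻¹                   ≈⟨ ∙-congʳ (sym (assoc _ _ _)) ⟩
        ((g ∙ x) ∙ y) ∙ g ⁻¹                   ≈⟨ ∙-congʳ (∙-congʳ (sym (//-rightDividesˡ g _))) ⟩
        ((((g ∙ x) ∙ g ⁻¹) ∙ g) ∙ y) ∙ g ⁻¹    ≈⟨ ∙-congʳ (assoc _ _ _) ⟩
        (((g ∙ x) ∙ g ⁻¹) ∙ (g ∙ y)) ∙ g ⁻¹    ≈⟨ assoc _ _ _ ⟩
        ((g ∙ x) ∙ g ⁻¹) ∙ ((g ∙ y) ∙ g ⁻¹)    ∎

  conjAut-isConj : ∀ g → IsConj g (conjAut g)
  conjAut-isConj g x = refl

  conj-ε : IsConj ε idᴬ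
  conj-ε x = sym (trans (∙-cong (identityˡ x) ε⁻¹≈ε) (identityʳ x))

  conj-mul : ∀ {s t} α β → IsConj s α → IsConj t β → IsConj (s ∙ t) (α ∘ᴬ β)
  conj-mul {s} {t} α β p q x = begin
    to α (to β x)                   ≈⟨ to-cong α (q x) ⟩
    to α ((t ∙ x) ∙ t ⁻¹)           ≈⟨ p _ ⟩
    (s ∙ ((t ∙ x) ∙ t ⁻¹)) ∙ s ⁻¹   ≈⟨ ∙-congʳ (sym (assoc _ _ _)) ⟩
    ((s ∙ (t ∙ x)) ∙ t ⁻¹) ∙ s ⁻¹   ≈⟨ assoc _ _ _ ⟩
    (s ∙ (t ∙ x)) ∙ (t ⁻¹ ∙ s ⁻¹)   ≈⟨ ∙-cong (sym (assoc _ _ _)) (sym (⁻¹-anti-homo-∙ s t)) ⟩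
    ((s ∙ t) ∙ x) ∙ (s ∙ t) ⁻¹      ∎

  conj-inv : ∀ {s} α → IsConj s α → IsConj (s ⁻¹) (α ⁻¹ᴬ)
  conj-inv {s} α p x = begin
    from α x                          ≈⟨ from-cong α (sym (trans (p _) (conj-conj⁻ s x))) ⟩
    from α (to α ((s ⁻¹ ∙ x) ∙ s))    ≈⟨ from-to α _ ⟩
    (s ⁻¹ ∙ x) ∙ s                    ≈⟨ ∙-congˡ (sym (⁻¹-involutive s)) ⟩
    (s ⁻¹ ∙ x) ∙ s ⁻¹ ⁻¹              ∎

  conj-respˢ : ∀ {s t} α → s ≈ t → IsConj s α → IsConj t α
  conj-respˢ α p q x = trans (q x) (∙-cong (∙-congʳ p) (⁻¹-cong p))

  conj-respᴬ : ∀ {s} α β → α ≃ β → IsConj s α → IsConj s β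
  conj-respᴬ α β p q x = trans (sym (p x)) (q x)

  inner-resp : ∀ α β → α ≃ β → IsInner T α → IsInner T β
  inner-resp α β p (s , q) = s , conj-respᴬ α β p q

  conj-trivial : ∀ α → IsConj ε α → α ≃ idᴬ
  conj-trivial α p x = trans (p x) (sym (conj-ε x))

  -- Inn(T) is normal in Aut(T):  γ ∘ conj(s) ∘ γ⁻¹ = conj(γ s).
  conj-by : ∀ {s} α γ → IsConj s α → IsConj (to γ s) (γ ∘ᴬ α ∘ᴬ γ ⁻¹ᴬ)
  conj-by {s} α γ p x = begin
    to γ (to α (from γ x))                    ≈⟨ to-cong γ (p _) ⟩
    to γ ((s ∙ from γ x) ∙ s ⁻¹)              ≈⟨ to-hom γ _ _ ⟩
    to γ (s ∙ from γ x) ∙ to γ (s ⁻¹)         ≈⟨ ∙-cong (to-hom γ _ _) (to-⁻¹ γ s) ⟩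
    (to γ s ∙ to γ (from γ x)) ∙ to γ s ⁻¹    ≈⟨ ∙-congʳ (∙-congˡ (to-from γ x)) ⟩
    (to γ s ∙ x) ∙ to γ s ⁻¹                  ∎

  -- The cosets Inn(T)·m: since Inn(T) ⊴ Aut(T), if f m⁻¹ and g m′⁻¹ are
  -- inner then so are (f g)(m m′)⁻¹ = (f m⁻¹)·m(g m′⁻¹)m⁻¹ and
  -- f⁻¹ (m⁻¹)⁻¹ = m⁻¹ (f m⁻¹)⁻¹ (m⁻¹)⁻¹.
  inner-coset-mul : ∀ f g m m′ → IsInner T (f ∘ᴬ m ⁻¹ᴬ) → IsInner T (g ∘ᴬ m′ ⁻¹ᴬ) →
                    IsInner T ((f ∘ᴬ g) ∘ᴬ (m ∘ᴬ m′) ⁻¹ᴬ)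
  inner-coset-mul f g m m′ (s , fm⁻¹=s) (s′ , gm′⁻¹=s′) =
    _ , conj-respᴬ ((f ∘ᴬ m ⁻¹ᴬ) ∘ᴬ m∘gm′⁻¹∘m⁻¹) ((f ∘ᴬ g) ∘ᴬ (m ∘ᴬ m′) ⁻¹ᴬ)
          (λ x → to-cong f (from-to m _))
          (conj-mul (f ∘ᴬ m ⁻¹ᴬ) m∘gm′⁻¹∘m⁻¹ fm⁻¹=s (conj-by (g ∘ᴬ m′ ⁻¹ᴬ) m gm′⁻¹=s′))
    where
      m∘gm′⁻¹∘m⁻¹ : Aut
      m∘gm′⁻¹∘m⁻¹ = m ∘ᴬ (g ∘ᴬ m′ ⁻¹ᴬ) ∘ᴬ m ⁻¹ᴬ

  inner-coset-inv : ∀ f m → IsInner T (f ∘ᴬ m ⁻¹ᴬ) → IsInner T (f ⁻¹ᴬ ∘ᴬ m ⁻¹ᴬ ⁻¹ᴬ)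
  inner-coset-inv f m (s , fm⁻¹=s) =
    _ , conj-respᴬ (m ⁻¹ᴬ ∘ᴬ (f ∘ᴬ m ⁻¹ᴬ) ⁻¹ᴬ ∘ᴬ m ⁻¹ᴬ ⁻¹ᴬ) (f ⁻¹ᴬ ∘ᴬ m ⁻¹ᴬ ⁻¹ᴬ)
          (λ x → from-to m _)
          (conj-by ((f ∘ᴬ m ⁻¹ᴬ) ⁻¹ᴬ) (m ⁻¹ᴬ) (conj-inv (f ∘ᴬ m ⁻¹ᴬ) fm⁻¹=s))

-- The power Aut(T)^k.

module Powers {c ℓ : Level} (T : Group c ℓ) where
  open Group T using (refl; sym)
  open Automorphisms T

  pow-isSubgroup : ∀ {k} {S : Pred Aut (c ⊔ ℓ)} →
                   IsSubgroup (AutOps T) S → IsSubgroup (PowOps T k) (_^ᵖ_ T S k)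
  pow-isSubgroup sS = record
    { resp = λ e p i → resp (e i) (p i)
    ; has-e = λ i → has-e
    ; mul = λ p q i → mul (p i) (q i)
    ; inv-closed = λ p i → inv-closed (p i) }
    where open IsSubgroup sS

  PowDiag : (k : ℕ) → Pred Aut (c ⊔ ℓ) → Pred Aut (c ⊔ ℓ) → Pred (Fin k → Aut) (c ⊔ ℓ)
  PowDiag k X Y f = (_^ᵖ_ T X k) f ⊎ Diag T k Y f

  PowDiag-⊆-pow : ∀ {k} X Y → IsSubgroup (AutOps T) Y → X ⊆ Y →
                  Gen (PowOps T k) (PowDiag k X Y) ⊆ _^ᵖ_ T Y k
  PowDiag-⊆-pow X Y sY X⊆Y = Gen-least (pow-isSubgroup sY) λ
    { (inj₁ p) i → X⊆Y (p i)
    ; (inj₂ (y , yY , f≃y)) i → IsSubgroup.resp sY (λ x → sym (f≃y i x)) yY }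

  PowDiag-mono : ∀ {k} X X′ Y Y′ → X ⊆ X′ → Y ⊆ Y′ →
                 Gen (PowOps T k) (PowDiag k X Y) ⊆ Gen (PowOps T k) (PowDiag k X′ Y′)
  PowDiag-mono X X′ Y Y′ X⊆X′ Y⊆Y′ = Gen-least Gen-isSubgroup λ
    { (inj₁ p) → gen (inj₁ λ i → X⊆X′ (p i))
    ; (inj₂ (y , yY , f≃y)) → gen (inj₂ (y , Y⊆Y′ yY , f≃y)) }

  PowDiag-reindex : ∀ {k} X Y (π : Fin k → Fin k) {f} →
                    Gen (PowOps T k) (PowDiag k X Y) f →
                    Gen (PowOps T k) (PowDiag k X Y) (λ i → f (π i))
  PowDiag-reindex X Y π = reindex
    where
      reindex : ∀ {f} → Gen (PowOps T _) (PowDiag _ X Y) f →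
                Gen (PowOps T _) (PowDiag _ X Y) (λ i → f (π i))
      reindex (gen (inj₁ p))              = gen (inj₁ λ i → p (π i))
      reindex (gen (inj₂ (y , yY , f≃y))) = gen (inj₂ (y , yY , λ i → f≃y (π i)))
      reindex gen-e                       = gen-e
      reindex (gen-mul p q)               = gen-mul (reindex p) (reindex q)
      reindex (gen-inv p)                 = gen-inv (reindex p)
      reindex (gen-resp e p)              = gen-resp (λ i → e (π i)) (reindex p)

  sing : ∀ {k} → Fin k → Aut → Fin k → Aut
  sing zero    α zero    = α
  sing zero    α (suc i) = idᴬ
  sing (suc j) α zero    = idᴬ
  sing (suc j) α (suc i) = sing j α i

  sing-∈ : ∀ {k p} (S : Pred Aut p) (j : Fin k) {α} → S idᴬ → S α → ∀ i → S (sing j α i)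
  sing-∈ S zero    e∈S α∈S zero    = α∈S
  sing-∈ S zero    e∈S α∈S (suc i) = e∈S
  sing-∈ S (suc j) e∈S α∈S zero    = e∈S
  sing-∈ S (suc j) e∈S α∈S (suc i) = sing-∈ S j e∈S α∈S i

  sing-cong : ∀ {k} (j : Fin k) α β → α ≃ β → ∀ i → sing j α i ≃ sing j β i
  sing-cong zero    α β e zero    = e
  sing-cong zero    α β e (suc i) = λ x → refl
  sing-cong (suc j) α β e zero    = λ x → refl
  sing-cong (suc j) α β e (suc i) = sing-cong j α β e i

  sing-id : ∀ {k} (j : Fin k) i → idᴬ ≃ sing j idᴬ i
  sing-id j i = sing-∈ (idᴬ ≃_) j (λ x → refl) (λ x → refl) i

  sing-mul : ∀ {k} (j : Fin k) α β i → sing j α i ∘ᴬ sing j β i ≃ sing j (α ∘ᴬ β) i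
  sing-mul zero    α β zero    = λ x → refl
  sing-mul zero    α β (suc i) = λ x → refl
  sing-mul (suc j) α β zero    = λ x → refl
  sing-mul (suc j) α β (suc i) = sing-mul j α β i

  sing-inv : ∀ {k} (j : Fin k) α i → sing j α i ⁻¹ᴬ ≃ sing j (α ⁻¹ᴬ) i
  sing-inv zero    α zero    = λ x → refl
  sing-inv zero    α (suc i) = λ x → refl
  sing-inv (suc j) α zero    = λ x → refl
  sing-inv (suc j) α (suc i) = sing-inv j α i

  sing-conj : ∀ {k} (f : Fin k → Aut) j α i →
              f i ∘ᴬ sing j α i ∘ᴬ f i ⁻¹ᴬ ≃ sing j (f j ∘ᴬ α ∘ᴬ f j ⁻¹ᴬ) i
  sing-conj f zero    α zero    = λ x → refl
  sing-conj f zero    α (suc i) = to-from (f (suc i))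
  sing-conj f (suc j) α zero    = to-from (f zero)
  sing-conj f (suc j) α (suc i) = sing-conj (λ l → f (suc l)) j α i

  -- A subgroup of Aut(T)^k containing every single-coordinate vector with
  -- entry in X contains X^k  (f = sing 0 (f 0) · (1, f 1, …, f (k-1))).
  singles-generate : ∀ {k S} (X : Pred Aut (c ⊔ ℓ)) → IsSubgroup (PowOps T k) S →
                     (∀ j {α} → X α → S (sing j α)) → _^ᵖ_ T X k ⊆ S
  singles-generate {zero} X sS singles _ = IsSubgroup.resp sS (λ ()) (IsSubgroup.has-e sS)
  singles-generate {suc k} {S} X sS singles {f} f∈Xᵏ =
    resp split (mul (singles zero (f∈Xᵏ zero))
                    (singles-generate {S = S′} X tail-isSubgroup
                       (λ j α∈X → resp (λ { zero x → refl ; (suc i) x → refl }) (singles (suc j) α∈X))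
                       (λ i → f∈Xᵏ (suc i))))
    where
      open IsSubgroup sS
      S′ : Pred (Fin k → Aut) (c ⊔ ℓ)
      S′ g = S (idᴬ ∷ g)
      tail-isSubgroup : IsSubgroup (PowOps T k) S′
      tail-isSubgroup = record
        { resp = λ e → resp λ { zero x → refl ; (suc i) → e i }
        ; has-e = resp (λ { zero x → refl ; (suc i) x → refl }) has-e
        ; mul = λ p q → resp (λ { zero x → refl ; (suc i) x → refl }) (mul p q)
        ; inv-closed = λ p → resp (λ { zero x → refl ; (suc i) x → refl }) (inv-closed p) }
      split : ∀ i → sing zero (f zero) i ∘ᴬ (idᴬ ∷ (λ l → f (suc l))) i ≃ f i
      split zero    x = refl
      split (suc i) x = refl

  -- Inn(T)^k · N  for N ≤ Aut(T)^k:  f = (f m⁻¹) m  with m ∈ N and f m⁻¹ inner.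
  InnerTimes : ∀ {k} → Pred (Fin k → Aut) (c ⊔ ℓ) → Pred (Fin k → Aut) (c ⊔ ℓ)
  InnerTimes N f = ∃ λ m → N m × (∀ i → IsInner T (f i ∘ᴬ m i ⁻¹ᴬ))

  coset-split : ∀ {k} (f m : Fin k → Aut) i → (f i ∘ᴬ m i ⁻¹ᴬ) ∘ᴬ m i ≃ f i
  coset-split f m i x = to-cong (f i) (from-to (m i) x)

  InnerTimes-isSubgroup : ∀ {k} {N : Pred (Fin k → Aut) (c ⊔ ℓ)} →
                          IsSubgroup (PowOps T k) N → IsSubgroup (PowOps T k) (InnerTimes N)
  InnerTimes-isSubgroup sN = record
    { resp = λ { {f} {f′} f≃f′ (m , m∈N , fm⁻¹∈Inn) → m , m∈N , λ i →
                 inner-resp (f i ∘ᴬ m i ⁻¹ᴬ) (f′ i ∘ᴬ m i ⁻¹ᴬ)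
                   (λ x → f≃f′ i (from (m i) x)) (fm⁻¹∈Inn i) }
    ; has-e = (λ _ → idᴬ) , has-e , (λ i → _ , conj-ε)
    ; mul = λ { {f} {g} (m , m∈N , fm⁻¹∈Inn) (m′ , m′∈N , gm′⁻¹∈Inn) →
                _ , mul m∈N m′∈N , λ i →
                inner-coset-mul (f i) (g i) (m i) (m′ i) (fm⁻¹∈Inn i) (gm′⁻¹∈Inn i) }
    ; inv-closed = λ { {f} (m , m∈N , fm⁻¹∈Inn) →
                _ , inv-closed m∈N , λ i → inner-coset-inv (f i) (m i) (fm⁻¹∈Inn i) } }
    where open IsSubgroup sN

-- The wreath product Aut(T) ≀ S_k.

module Wreath {c ℓ : Level} (T : Group c ℓ) (k : ℕ) where
  open Group T using (refl)
  open Automorphisms T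

  PermClosed : Pred (Fin k → Aut) (c ⊔ ℓ) → Set (c ⊔ ℓ)
  PermClosed N = ∀ (σ : Permutation′ k) {f} → N f → N (λ i → f (σ ⟨$⟩ʳ i))

  ⋊Sym-isSubgroup : ∀ {N} → IsSubgroup (PowOps T k) N → PermClosed N →
                    IsSubgroup (WrOps T k) (_⋊Sym T N)
  ⋊Sym-isSubgroup sN permN = record
    { resp = λ e → resp (proj₁ e)
    ; has-e = has-e
    ; mul = λ { {f ⋊ σ} p q → mul p (permN (P.flip σ) q) }
    ; inv-closed = λ { {f ⋊ σ} p → inv-closed (permN σ p) } }
    where open IsSubgroup sN

  1ᵏ : Fin k → Aut
  1ᵏ _ = idᴬ

  transpose-self : (a b : Fin k) → PC.transpose a b a ≡ b
  transpose-self a b rewrite dec-true (a ≟ a) Eq.refl = Eq.refl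

  -- A subgroup K of the wreath product containing S_k is K₀ ⋊ S_k for its
  -- base K₀ = {f | (f, 1) ∈ K}, a subgroup of Aut(T)^k normalised by S_k.
  module Base (K : Pred (WrElem T k) (c ⊔ ℓ)) (sK : IsSubgroup (WrOps T k) K)
              (perms : ∀ σ → K (1ᵏ ⋊ σ)) where
    open IsSubgroup sK

    K₀ : Pred (Fin k → Aut) (c ⊔ ℓ)
    K₀ f = K (f ⋊ P.id)

    toBase : ∀ {f σ} → K (f ⋊ σ) → K₀ f
    toBase {σ = σ} p = resp ((λ i x → refl) , λ i → P.inverseʳ σ) (mul p (perms (P.flip σ)))

    fromBase : ∀ {f} σ → K₀ f → K (f ⋊ σ)
    fromBase σ p = resp ((λ i x → refl) , λ i → Eq.refl) (mul p (perms σ))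

    K₀-isSubgroup : IsSubgroup (PowOps T k) K₀
    K₀-isSubgroup = record
      { resp = λ e → resp (e , λ i → Eq.refl)
      ; has-e = has-e
      ; mul = λ p q → toBase (mul p q)
      ; inv-closed = λ p → toBase (inv-closed p) }

    K₀-permClosed : PermClosed K₀
    K₀-permClosed σ p = resp ((λ i x → refl) , λ i → Eq.refl) (toBase (mul (perms (P.flip σ)) p))

    K₀-move : ∀ {f} → K₀ f → ∀ i j → ∃ λ g → K₀ g × g j ≃ f i
    K₀-move {f} p i j = _ , K₀-permClosed (P.transpose j i) p , ≡⇒≃ (Eq.cong f (transpose-self j i))

module InnerPower {c ℓ : Level} (T : Group c ℓ) (simple : IsSimple T) {k : ℕ}
  (K₀ : Pred (Fin k → Automorphism T) (c ⊔ ℓ)) (sK₀ : IsSubgroup (PowOps T k) K₀)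
  (realise : ∀ j g → ∃ λ f → K₀ f × Automorphisms.IsConj T g (f j))
  (witness : ∃ λ α → IsInner T α × ¬ (_≈Aut_ T α (autId T)) × (∀ j → K₀ (Powers.sing T j α)))
  where
  open Group T
  open Automorphisms T
  open Powers T
  open IsSubgroup sK₀

  R : Fin k → Pred Carrier (c ⊔ ℓ)
  R j s = ∃ λ α → IsConj s α × K₀ (sing j α)

  R-normal : ∀ j → IsNormalSubgroup T (R j)
  R-normal j = record
    { resp = λ { s≈t (α , cs , p) → α , conj-respˢ α s≈t cs , p }
    ; has-ε = idᴬ , conj-ε , resp (sing-id j) has-e
    ; mul = λ { (α , cs , p) (β , ct , q) → _ , conj-mul α β cs ct , resp (sing-mul j α β) (mul p q) }
    ; inv-closed = λ { (α , cs , p) → _ , conj-inv α cs , resp (sing-inv j α) (inv-closed p) }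
    ; conj = conjugate }
    where
      -- if f ∈ K₀ has f j = conj(g), then  f · sing j α · f⁻¹ = sing j (conj(g) α conj(g)⁻¹).
      conjugate : ∀ {s} g → R j s → R j ((g ∙ s) ∙ g ⁻¹)
      conjugate g (α , cs , p) with realise j g
      ... | f , f∈K₀ , fj=g =
        _ , conj-respˢ (f j ∘ᴬ α ∘ᴬ f j ⁻¹ᴬ) (fj=g _) (conj-by α (f j) cs) ,
        resp (sing-conj f j α) (mul f∈K₀ (mul p (inv-closed f∈K₀)))

  -- R j is not trivial, hence all of T.
  R-full : ∀ j s → R j s
  R-full j s with proj₂ simple (R j) (R-normal j)
  ... | inj₂ all  = all s
  ... | inj₁ triv =
    let (α , (s₀ , α=s₀) , α≠1 , sing∈K₀) = witness in
    ⊥-elim (α≠1 (conj-trivial α (conj-respˢ α (triv s₀ (α , α=s₀ , sing∈K₀ j)) α=s₀)))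

  inner-power : _^ᵖ_ T (IsInner T) k ⊆ K₀
  inner-power = singles-generate (IsInner T) sK₀ λ { j {α} (s , α=s) →
    let (α′ , cs , p) = R-full j s
    in resp (sing-cong j α′ α (λ x → trans (cs x) (sym (α=s x)))) p }

module Maximality {c ℓ : Level} (T : Group c ℓ) (simple : IsSimple T)
  (A B H : Pred (Automorphism T) (c ⊔ ℓ))
  (sA : IsSubgroup (AutOps T) A) (sB : IsSubgroup (AutOps T) B)
  (Inn⊆A : IsInner T ⊆ A) (A⊆B : A ⊆ B)
  (maxH : IsMaximalSubgroupOf (AutOps T) H B)
  (B=InnH : ∀ {b} → B b → ∃₂ λ t h → IsInner T t × H h × _≈Aut_ T b (autComp T t h))
  (T∩H≠1 : ∃ λ t → IsInner T t × H t × ¬ (_≈Aut_ T t (autId T)))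
  (k′ : ℕ) where
  open Group T using (refl; sym; trans)
  open Automorphisms T
  open Powers T
  open Wreath T (suc k′)
  open IsMaximalSubgroupOf maxH using () renaming (subgroup to sH; sub to H⊆B)

  k : ℕ
  k = suc k′

  A∩H : Pred Aut (c ⊔ ℓ)
  A∩H = _∩_ T A H

  Lᵇ Gᵇ : Pred (Fin k → Aut) (c ⊔ ℓ)
  Lᵇ = Gen (PowOps T k) (PowDiag k A∩H H)
  Gᵇ = Gen (PowOps T k) (PowDiag k A B)

  L G : Pred (WrElem T k) (c ⊔ ℓ)
  L = _⋊Sym T Lᵇ
  G = _⋊Sym T Gᵇ

  Lᵇ⊆Hᵏ : Lᵇ ⊆ _^ᵖ_ T H k
  Lᵇ⊆Hᵏ = PowDiag-⊆-pow A∩H H sH proj₂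

  Gᵇ⊆Bᵏ : Gᵇ ⊆ _^ᵖ_ T B k
  Gᵇ⊆Bᵏ = PowDiag-⊆-pow A B sB A⊆B

  Lᵇ⊆Gᵇ : Lᵇ ⊆ Gᵇ
  Lᵇ⊆Gᵇ = PowDiag-mono A∩H A H B proj₁ H⊆B

  B-factor : ∀ {b} → B b → ∃ λ h → H h × IsInner T (b ∘ᴬ h ⁻¹ᴬ)
  B-factor {b} b∈B with B=InnH b∈B
  ... | t , h , t∈Inn , h∈H , b=th =
    h , h∈H , inner-resp t (b ∘ᴬ h ⁻¹ᴬ)
                (λ x → sym (trans (b=th (from h x)) (to-cong t (to-from h x)))) t∈Inn

  -- For a ∈ A the factor h = (a h⁻¹)⁻¹ a lies in A as well, since Inn(T) ≤ A.
  A-factor : ∀ {a} → A a → ∃ λ h → A∩H h × IsInner T (a ∘ᴬ h ⁻¹ᴬ)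
  A-factor {a} a∈A with B-factor (A⊆B a∈A)
  ... | h , h∈H , ah⁻¹∈Inn = h , (h∈A , h∈H) , ah⁻¹∈Inn
    where
      h∈A : A h
      h∈A = IsSubgroup.resp sA (λ x → to-cong h (from-to a x))
              (IsSubgroup.mul sA (IsSubgroup.inv-closed sA (Inn⊆A {a ∘ᴬ h ⁻¹ᴬ} ah⁻¹∈Inn)) a∈A)

  -- Gᵇ = Inn(T)^k · Lᵇ, as the generators of Gᵇ factor so.
  Gᵇ⊆Inn·Lᵇ : Gᵇ ⊆ InnerTimes Lᵇ
  Gᵇ⊆Inn·Lᵇ = Gen-least (InnerTimes-isSubgroup Gen-isSubgroup) λ
    { (inj₁ f∈Aᵏ) → let factor = λ i → A-factor (f∈Aᵏ i) in
        (λ i → proj₁ (factor i)) , gen (inj₁ λ i → proj₁ (proj₂ (factor i))) ,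
        (λ i → proj₂ (proj₂ (factor i)))
    ; {f} (inj₂ (b , b∈B , f≃b)) → let (h , h∈H , bh⁻¹∈Inn) = B-factor b∈B in
        (λ _ → h) , gen (inj₂ (h , h∈H , λ i x → refl)) ,
        λ i → inner-resp (b ∘ᴬ h ⁻¹ᴬ) (f i ∘ᴬ h ⁻¹ᴬ)
                (λ x → sym (f≃b i (from h x))) bh⁻¹∈Inn }

  -- An element f = (f m⁻¹) m of Gᵇ with all coordinates in H lies in Lᵇ,
  -- because then f m⁻¹ ∈ (Inn(T) ∩ H)^k ⊆ (A ∩ H)^k.
  Gᵇ∩Hᵏ⊆Lᵇ : ∀ {f} → Gᵇ f → _^ᵖ_ T H k f → Lᵇ f
  Gᵇ∩Hᵏ⊆Lᵇ {f} f∈Gᵇ f∈Hᵏ with Gᵇ⊆Inn·Lᵇ f∈Gᵇ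
  ... | m , m∈Lᵇ , fm⁻¹∈Inn = gen-resp (coset-split f m) (gen-mul fm⁻¹∈Lᵇ m∈Lᵇ)
    where
      fm⁻¹∈Lᵇ : Lᵇ (λ i → f i ∘ᴬ m i ⁻¹ᴬ)
      fm⁻¹∈Lᵇ = gen (inj₁ λ i → Inn⊆A (fm⁻¹∈Inn i) ,
                  IsSubgroup.mul sH (f∈Hᵏ i) (IsSubgroup.inv-closed sH (Lᵇ⊆Hᵏ m∈Lᵇ i)))

  L-isSubgroup : IsSubgroup (WrOps T k) L
  L-isSubgroup = ⋊Sym-isSubgroup Gen-isSubgroup λ σ → PowDiag-reindex A∩H H (σ ⟨$⟩ʳ_)

  L-proper : ∃ λ x → G x × ¬ L x
  L-proper with IsMaximalSubgroupOf.proper maxH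
  ... | b , b∈B , b∉H = ((λ _ → b) ⋊ P.id) , gen (inj₂ (b , b∈B , λ i x → refl)) ,
                        λ b∈Lᵇ → b∉H (Lᵇ⊆Hᵏ b∈Lᵇ zero)

  -- A subgroup K with L ≤ K ≤ G is L or G, according as the projection Π of
  -- its base to the first coordinate is H or B.
  module Between (K : Pred (WrElem T k) (c ⊔ ℓ)) (sK : IsSubgroup (WrOps T k) K)
                 (L⊆K : L ⊆ K) (K⊆G : K ⊆ G) where
    open Base K sK (λ σ → L⊆K gen-e)
    open IsSubgroup K₀-isSubgroup

    Π : Pred Aut (c ⊔ ℓ)
    Π α = ∃ λ f → K₀ f × f zero ≃ α

    Π-isSubgroup : IsSubgroup (AutOps T) Π
    Π-isSubgroup = record
      { resp = λ { α≃β (f , p , f0≃α) → f , p , λ x → trans (f0≃α x) (α≃β x) }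
      ; has-e = 1ᵏ , has-e , (λ x → refl)
      ; mul = λ { (f , p , f0≃α) (g , q , g0≃β) →
                  _ , mul p q , λ x → trans (to-cong (f zero) (g0≃β x)) (f0≃α _) }
      ; inv-closed = λ { {α} (f , p , f0≃α) → _ , inv-closed p , ⁻¹ᴬ-cong (f zero) α f0≃α } }

    Lᵇ⊆K₀ : Lᵇ ⊆ K₀
    Lᵇ⊆K₀ {f} = L⊆K {f ⋊ P.id}

    H⊆Π : H ⊆ Π
    H⊆Π {h} h∈H = (λ _ → h) , Lᵇ⊆K₀ (gen (inj₂ (h , h∈H , λ i x → refl))) , (λ x → refl)

    Π⊆B : Π ⊆ B
    Π⊆B (f , p , f0≃α) = IsSubgroup.resp sB f0≃α (Gᵇ⊆Bᵏ (K⊆G p) zero)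

    -- If Π = H, every coordinate of every element of K₀ lies in H, so K ≤ L.
    K⊆L : Π ⊆ H → K ⊆ L
    K⊆L Π⊆H {f ⋊ σ} p = Gᵇ∩Hᵏ⊆Lᵇ (K⊆G p) λ i →
      let (g , q , g0≃fi) = K₀-move (toBase p) i zero in Π⊆H (g , q , g0≃fi)

    -- If Π = B, then every conjugation conj(g) occurs at every coordinate of K₀ …
    realise : B ⊆ Π → ∀ j g → ∃ λ h → K₀ h × IsConj g (h j)
    realise B⊆Π j g with B⊆Π (A⊆B (Inn⊆A {conjAut g} (g , conjAut-isConj g)))
    ... | f , p , f0≃g with K₀-move p zero j
    ...   | h , q , hj≃f0 =
      h , q , conj-respᴬ (conjAut g) (h j) (λ x → sym (trans (hj≃f0 x) (f0≃g x)))
                (conjAut-isConj g)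

    -- … while T ∩ H ≠ 1 provides a nontrivial inner automorphism at each coordinate.
    witness : ∃ λ α → IsInner T α × ¬ (α ≃ idᴬ) × (∀ j → K₀ (sing j α))
    witness =
      let (t , t∈Inn , t∈H , t≠1) = T∩H≠1 in
      t , t∈Inn , t≠1 , λ j → Lᵇ⊆K₀ (gen (inj₁ (sing-∈ A∩H j
        (IsSubgroup.has-e sA , IsSubgroup.has-e sH) (Inn⊆A t∈Inn , t∈H))))

    -- Hence Inn(T)^k ≤ K₀, and then Gᵇ = Inn(T)^k · Lᵇ ≤ K₀, so G ≤ K.
    G⊆K : B ⊆ Π → G ⊆ K
    G⊆K B⊆Π {f ⋊ σ} p with Gᵇ⊆Inn·Lᵇ p
    ... | m , m∈Lᵇ , fm⁻¹∈Inn =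
      fromBase σ (resp (coset-split f m) (mul fm⁻¹∈K₀ (Lᵇ⊆K₀ m∈Lᵇ)))
      where
        fm⁻¹∈K₀ : K₀ (λ i → f i ∘ᴬ m i ⁻¹ᴬ)
        fm⁻¹∈K₀ = InnerPower.inner-power T simple K₀ K₀-isSubgroup (realise B⊆Π) witness fm⁻¹∈Inn

    L-or-G : (K ⊆ L) ⊎ (G ⊆ K)
    L-or-G with IsMaximalSubgroupOf.maximal maxH Π Π-isSubgroup H⊆Π Π⊆B
    ... | inj₁ Π⊆H = inj₁ (K⊆L Π⊆H)
    ... | inj₂ B⊆Π = inj₂ (G⊆K B⊆Π)

  maximal : (K : Pred (WrElem T k) (c ⊔ ℓ)) → IsSubgroup (WrOps T k) K → L ⊆ K → K ⊆ G →
            (K ⊆ L) ⊎ (G ⊆ K)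
  maximal = Between.L-or-G

  L-maximal : IsMaximalSubgroupOf (WrOps T k) L G
  L-maximal = record
    { subgroup = L-isSubgroup ; sub = Lᵇ⊆Gᵇ ; proper = L-proper ; maximal = maximal }

lemma4p4 : {c ℓ : Level} (T : Group c ℓ) → IsNonabelian T → IsSimple T →
           (A B H : Pred (Automorphism T) (c ⊔ ℓ)) →
           IsSubgroup (AutOps T) A → IsSubgroup (AutOps T) B →
           IsInner T ⊆ A → A ⊆ B →
           IsMaximalSubgroupOf (AutOps T) H B →
           (∀ {b} → B b → ∃₂ λ t h → IsInner T t × H h × (AutOps T GroupOps.≈ b) (autComp T t h)) →
           (∃ λ t → IsInner T t × H t × ¬ ((AutOps T GroupOps.≈ t) (autId T))) →
           (k : ℕ) → 1 ≤ k →
           IsMaximalSubgroupOf (WrOps T k)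
             (_⋊Sym T (Gen (PowOps T k) (λ f → (_^ᵖ_ T (_∩_ T A H) k) f ⊎ Diag T k H f)))
             (_⋊Sym T (Gen (PowOps T k) (λ f → (_^ᵖ_ T A k) f ⊎ Diag T k B f)))
lemma4p4 T _ simple A B H sA sB Inn⊆A A⊆B maxH B=InnH T∩H≠1 (suc k′) (s≤s z≤n) =
  Maximality.L-maximal T simple A B H sA sB Inn⊆A A⊆B maxH B=InnH T∩H≠1 k′
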